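{- Let $G$ be a static graph with $n$ nodes, let $p$ be a path in $G$, and let $\mathcal{C}_p=(p',\{(q_1,x_1),\dots,(q_m,x_m)\})$ be a complete path decomposition of $p$ satisfying Assumption A. Let $t$ be the canonical path composition of $\mathcal{C}_p$. Then $\mathrm{lshift}(t)\ge\mathrm{lshift}(p)-n$.
   Context: Static graph: given $M_{ -1},M_0,M_{+1}\in(\mathbb{Q}\cup\{ -\infty\})^{n\times n}$, $G$ is the weighted directed multigraph with nodes $\{1,\dots,n\}$ and an arc $(i,j,s)$ from $i$ to $j$ with shift $s\in\{ -1,0,+1\}$ and weight $(M_s)_{ji}$ whenever $(M_s)_{ji}\ne-\infty$. A path is $p=(v_1,e_1,v_2,\dots,v_m)$ with $e_i$ an arc from $v_i$ to $v_{i+1}$; $\mathrm{len}(p)=m-1$; $\mathrm{shift}(p)=\sum_{i=1}^{m-1}\mathrm{shift}(e_i)$; and the left-shift is $\mathrm{lshift}(p)=\min_{i\in\{0,\dots,m-1\}}\sum_{j=1}^{i}\mathrm{shift}(e_j)$ (empty sum $=0$). A circuit is a path with $v_1=v_m$; it is elementary if all its nodes except the first and last are pairwise distinct. Concatenation of paths is written by juxtaposition. Complete path decomposition (CPD): given a path $p=p_1qp_2$ where $q$ is an elementary circuit all of whose inner nodes occur elsewhere in $p$ (i.e., in $p_1$ or $p_2$), remove $q$ to obtain $p_1p_2$; repeat until no such circuit exists in the remaining path. If the process removed, for each $j$, $x_j$ occurrences of the elementary circuit $q_j$, and the remaining path is $p'$, then $\mathcal{C}_p=(p',\{(q_1,x_1),\dots,(q_m,x_m)\})$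 is a CPD of $p$. This yields a factorization $p=r_1r_2\cdots r_l$ where each $r_h$ is either a path of length $1$ or one of the removed occurrences of some $q_j$. Assumption A: every $q_j$ has nonzero shift, and for $q_j\ne q_h$, $(\mathrm{source}(q_j),\mathrm{shift}(q_j))\ne(\mathrm{source}(q_h),\mathrm{shift}(q_h))$. Canonical path composition (CPC): the output $t$ of the following procedure applied to $p$. (1) Set $s\leftarrow-n$, $i\leftarrow1$, $r\leftarrow p=r_1\cdots r_l$, and label from $1$ to $x_j$ the removed occurrences of each $q_j$. (2) Let $q_j$ be the circuit of $\mathcal{C}_p$ with shift $s$ and source $i$; if none exists go to (4). (3) For each $\xi=1,\dots,x_j$: let $r_h$ be the occurrence of $q_j$ labelled $\xi$ in $r$, and set $r^+=r_1\cdots r_{h-1}r_{h+1}\cdots r_yr_hr_{y+1}\cdots r_l$ if $s<0$, and $r^+=r_1\cdots r_yr_hr_{y+1}\cdots r_{h-1}r_{h+1}\cdots r_l$ if $s>0$, where $y$ is the maximal (if $s<0$) or minimal (if $s>0$) number in $\{0,\dots,l\}$ such that $\mathrm{source}(r_h)=\mathrm{target}(r_y)$ or $\mathrm{target}(r_h)=\mathrm{source}(r_{y+1})$; then re-index the factors of $r^+$ as $r_1,\dots,r_l$ and set $r\leftarrow r^+$. (4) Set $i\leftarrow i+1$; if $i=n+1$ set $s\leftarrow s+1$ and $i\leftarrow1$; if $s=n+1$ output $t\leftarrow r$ and stop, otherwise go to (2). (Informally, circuits with negative shift are postponed and circuits with positive shift anticipated as much as possible.) -}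

module Defs where

open import Data.Nat using (ℕ; zero; suc) renaming (_*_ to _*ℕ_)
open import Data.Integer using (ℤ; +_; _+_; _-_; _⊓_; _<_)
open import Data.Integer.Properties using (_<?_)
open import Data.Rational using (ℚ)
open import Data.Fin using (Fin) renaming (_≟_ to _≟ᶠ_)
open import Data.Maybe using (Maybe; just; nothing)
open import Data.List using (List; []; _∷_; _++_; map; concatMap; upTo; allFin)
open import Data.List.Membership.Propositional using (_∈_)
open import Data.List.Relation.Unary.All using (All)
open import Data.List.Relation.Unary.Unique.Propositional using (Unique)
open import Data.Product using (Σ; ∃; _×_; _,_; proj₁; proj₂)
open import Data.Bool using (Bool; true; false; if_then_else_; _∨_)
open import Data.Unit using (⊤)
open import Function using (_∘_)
open import Relation.Nullary using (¬_; does)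
open import Relation.Binary.PropositionalEquality using (_≡_; _≢_)
open import Relation.Binary.Construct.Closure.ReflexiveTransitive using (Star)

data Shift : Set where
  minus₁ zero₀ plus₁ : Shift

shiftℤ : Shift → ℤ
shiftℤ minus₁ = Data.Integer.-[1+ 0 ]
shiftℤ zero₀  = + 0
shiftℤ plus₁  = + 1

-- entries in ℚ ∪ {-∞}; nothing represents -∞
Matrix : ℕ → Set
Matrix n = Fin n → Fin n → Maybe ℚ

record StaticGraph (n : ℕ) : Set where
  field
    M₋₁ M₀ M₊₁ : Matrix n

matrix : ∀ {n} → StaticGraph n → Shift → Matrix n
matrix G minus₁ = StaticGraph.M₋₁ G
matrix G zero₀  = StaticGraph.M₀ G
matrix G plus₁  = StaticGraph.M₊₁ G

record Arc (n : ℕ) : Set where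
  constructor arc
  field
    source target : Fin n
    shift : Shift
open Arc public

ArcIn : ∀ {n} → StaticGraph n → Arc n → Set
ArcIn G a = ∃ λ (w : ℚ) → matrix G (shift a) (target a) (source a) ≡ just w

Chain : ∀ {n} → Fin n → List (Arc n) → Set
Chain v []       = ⊤
Chain v (a ∷ as) = source a ≡ v × Chain (target a) as

-- a path (v₁, e₁, v₂, …, v_m): its first node and its list of arcs
record Path (n : ℕ) : Set where
  constructor mkPath
  field
    start : Fin n
    arcs  : List (Arc n)
open Path public

IsPathIn : ∀ {n} → StaticGraph n → Path n → Set
IsPathIn G p = Chain (start p) (arcs p) × All (ArcIn G) (arcs p)

shiftSum : ∀ {n} → List (Arc n) → ℤ
shiftSum []       = + 0
shiftSum (a ∷ as) = shiftℤ (shift a) + shiftSum as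

-- min over i ∈ {0..m-1} of the prefix sums of shifts (empty sum = 0)
lshiftArcs : ∀ {n} → List (Arc n) → ℤ
lshiftArcs []       = + 0
lshiftArcs (a ∷ as) = + 0 ⊓ (shiftℤ (shift a) + lshiftArcs as)

lshift : ∀ {n} → Path n → ℤ
lshift p = lshiftArcs (arcs p)

lastTarget : ∀ {n} → Arc n → List (Arc n) → Fin n
lastTarget a []       = target a
lastTarget a (b ∷ bs) = lastTarget b bs

-- the path with arcs a ∷ as (nodes u₁ … u_k, u₁ = source a) is an
-- elementary circuit of length ≥ 1: u_k = u₁ and u₁ … u_{k-1} pairwise distinct
IsElemCircuit : ∀ {n} → Arc n → List (Arc n) → Set
IsElemCircuit a as =
  Chain (source a) (a ∷ as) × lastTarget a as ≡ source a × Unique (map source (a ∷ as))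

-- in the path p₁ q p₂ (p₁ starts at v, has arcs A; q has arcs a ∷ as;
-- p₂ has arcs B), q is an elementary circuit all of whose inner nodes
-- u₂ … u_{k-1} occur in p₁ or p₂
Removable : ∀ {n} → Fin n → List (Arc n) → Arc n → List (Arc n) → List (Arc n) → Set
Removable v A a as B =
  IsElemCircuit a as ×
  All (λ u → u ∈ ((v ∷ map target A) ++ (source a ∷ map target B))) (map source as)

-- Complete path decomposition, tracked as a factorization r₁ ⋯ r_l of p
-- where each factor is a single arc (still in the remaining path) or a
-- removed occurrence of an elementary circuit.

data Kind : Set where
  single removed : Kind

record Factor (n : ℕ) : Set where
  constructor factor
  field
    kind : Kind
    hd   : Arc n
    tl   : List (Arc n)
open Factor public

fArcs : ∀ {n} → Factor n → List (Arc n)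
fArcs f = hd f ∷ tl f

fSource : ∀ {n} → Factor n → Fin n
fSource f = source (hd f)

fTarget : ∀ {n} → Factor n → Fin n
fTarget f = lastTarget (hd f) (tl f)

fShift : ∀ {n} → Factor n → ℤ
fShift f = shiftSum (fArcs f)

singleF : ∀ {n} → Arc n → Factor n
singleF a = factor single a []

remaining : ∀ {n} → List (Factor n) → List (Arc n)
remaining []                        = []
remaining (factor single a t ∷ fs)  = a ∷ t ++ remaining fs
remaining (factor removed _ _ ∷ fs) = remaining fs

data CPDStep {n : ℕ} (v : Fin n) : List (Factor n) → List (Factor n) → Set where
  remove : ∀ L a as R →
    Removable v (remaining L) a as (remaining R) →
    CPDStep v (L ++ map singleF (a ∷ as) ++ R) (L ++ factor removed a as ∷ R)

Terminal : ∀ {n} → Fin n → List (Factor n) → Set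
Terminal v r = ∀ A a as B → remaining r ≡ A ++ (a ∷ as) ++ B → ¬ Removable v A a as B

IsCPD : ∀ {n} → Path n → List (Factor n) → Set
IsCPD p r = Star (CPDStep (start p)) (map singleF (arcs p)) r × Terminal (start p) r

AssumptionA : ∀ {n} → List (Factor n) → Set
AssumptionA r =
  (∀ f → f ∈ r → kind f ≡ removed → fShift f ≢ + 0) ×
  (∀ f g → f ∈ r → g ∈ r → kind f ≡ removed → kind g ≡ removed →
     fSource f ≡ fSource g → fShift f ≡ fShift g → fArcs f ≡ fArcs g)

-- Canonical path composition.
-- Factors carry a flag: true once the occurrence has been processed.

FF : ℕ → Set
FF n = Factor n × Bool

ffTarget : ∀ {n} → FF n → Fin n
ffTarget = fTarget ∘ proj₁

ffSource : ∀ {n} → FF n → Fin n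
ffSource = fSource ∘ proj₁

memNode : ∀ {n} → Fin n → List (Fin n) → Bool
memNode u []       = false
memNode u (w ∷ ws) = does (u ≟ᶠ w) ∨ memNode u ws

-- insert c at the last junction (from the junction with node cur on)
-- whose node is u
insertLast : ∀ {n} → Fin n → Fin n → FF n → List (FF n) → List (FF n)
insertLast u cur c []       = c ∷ []
insertLast u cur c (f ∷ fs) =
  if memNode u (ffTarget f ∷ map ffTarget fs)
  then f ∷ insertLast u (ffTarget f) c fs
  else c ∷ f ∷ fs

insertFirst : ∀ {n} → Fin n → Fin n → FF n → List (FF n) → List (FF n)
insertFirst u cur c []       = c ∷ []
insertFirst u cur c (f ∷ fs) =
  if does (cur ≟ᶠ u) then c ∷ f ∷ fs else f ∷ insertFirst u (ffTarget f) c fs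

-- r_h = c has been taken out of r (leaving rs); put it back as far right
-- (s < 0) or as far left (s > 0) as possible; v is the first node of p
place : ∀ {n} → ℤ → Fin n → FF n → List (FF n) → List (FF n)
place s v c rs =
  if does (s <? + 0) then insertLast (ffSource c) v c rs else insertFirst (ffSource c) v c rs

IsOcc : ∀ {n} → ℤ → Fin n → FF n → Set
IsOcc s i (f , b) = kind f ≡ removed × b ≡ false × fSource f ≡ i × fShift f ≡ s

-- step (3) for a given (s , i): move every occurrence once, in any order
data Round {n : ℕ} (v : Fin n) (s : ℤ) (i : Fin n) : List (FF n) → List (FF n) → Set where
  finish : ∀ r → (∀ x → x ∈ r → ¬ IsOcc s i x) → Round v s i r r
  move   : ∀ L f R r′ → IsOcc s i (f , false) →
    Round v s i (place s v (f , true) (L ++ R)) r′ →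
    Round v s i (L ++ (f , false) ∷ R) r′

-- the pairs (s , i) in the order visited: s = -n … n, i = 1 … n
schedule : (n : ℕ) → List (ℤ × Fin n)
schedule n = concatMap (λ k → map (λ i → (+ k - + n , i)) (allFin n)) (upTo (suc (2 *ℕ n)))

data Rounds {n : ℕ} (v : Fin n) : List (ℤ × Fin n) → List (FF n) → List (FF n) → Set where
  []  : ∀ {r} → Rounds v [] r r
  _∷_ : ∀ {s i sch r r₁ r₂} → Round v s i r r₁ → Rounds v sch r₁ r₂ → Rounds v ((s , i) ∷ sch) r r₂

IsCPC : ∀ {n} → Path n → List (Factor n) → Path n → Set
IsCPC {n} p r t =
  Σ (List (FF n)) λ out →
    Rounds (start p) (schedule n) (map (λ f → (f , false)) r) out ×
    t ≡ mkPath (start p) (concatMap (fArcs ∘ proj₁) out)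

-- Follow the factorization of p through the decomposition and the composition, keeping three
-- facts: the factors form a path from the first node of p, every removed factor is a closed
-- circuit with at most n arcs (its nodes are pairwise distinct), and the running shift at every
-- junction between factors is at least lshift p. Initially the junctions are the nodes of p, and
-- removing a circuit only deletes junctions. A circuit of negative shift is moved to a later
-- junction at its source, one of nonnegative shift to an earlier one; either way the junctions it
-- passes over gain shift. Finally, inside a factor of at most n arcs, each of shift at least -1,
-- the running shift lies at most n below the preceding junction.

{-# OPTIONS --safe #-}
module Submission where

open import Defs
open import Data.Nat using (ℕ; zero; suc; >-nonZero⁻¹) renaming (_≤_ to _≤ℕ_)
open import Data.Integer using (ℤ; +_; _+_; _-_; -_; _⊓_; _≤_; _≥_; -[1+_]; +≤+; -≤+)
open import Data.Integer.Properties
  using (≤-refl; ≤-trans; ≤-reflexive; <⇒≤; ≮⇒≥; +-assoc; +-identityˡ; +-identityʳ; +-monoʳ-≤; +-mono-≤;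
         neg-≤-pos; neg-mono-≤; i⊓j≤i; i⊓j≤j; ⊓-glb; ⊓-assoc; i≥j⇒i⊓j≡j; mono-≤-distrib-⊓; _<?_;
         +-commutativeSemigroup)
open import Algebra.Properties.CommutativeSemigroup +-commutativeSemigroup using (xy∙z≈xz∙y)
open import Data.Fin using (Fin; zero; suc) renaming (_≟_ to _≟ᶠ_)
open import Data.Fin.Properties using (injective⇒≤; nonZeroIndex)
open import Data.List using (List; []; _∷_; _++_; map; length; lookup; concatMap)
open import Data.List.Properties using (length-map; ++-assoc)
open import Data.List.Membership.Propositional using (_∈_)
open import Data.List.Membership.Propositional.Properties using (∈-lookup)
open import Data.List.Relation.Unary.Any using (here; there)
import Data.List.Relation.Unary.All as All
open import Data.List.Relation.Unary.AllPairs using (_∷_)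
open import Data.List.Relation.Unary.Unique.Propositional using (Unique)
open import Data.Product using (∃₂; _×_; _,_; proj₁; proj₂)
open import Data.Sum using (_⊎_; inj₁; inj₂)
open import Data.Bool using (true; false)
open import Data.Bool.Properties using (∨-zeroʳ)
open import Data.Empty using (⊥-elim)
open import Function using (_∘_; id)
open import Function.Definitions using (Injective)
open import Relation.Nullary using (yes; no; contradiction)
open import Relation.Nullary.Decidable using (dec-true)
open import Relation.Binary.PropositionalEquality
  using (_≡_; refl; sym; trans; cong; cong₂; subst; subst₂; module ≡-Reasoning)
open import Relation.Binary.Construct.Closure.ReflexiveTransitive using (Star; ε; _◅_)

+-distribˡ-⊓ : ∀ b x y → b + (x ⊓ y) ≡ (b + x) ⊓ (b + y)
+-distribˡ-⊓ b = mono-≤-distrib-⊓ (+-monoʳ-≤ b)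

≤-+⊓ : ∀ {k b x y} → k ≤ b + x → k ≤ b + y → k ≤ b + (x ⊓ y)
≤-+⊓ {k} {b} {x} {y} kx ky = subst (k ≤_) (sym (+-distribˡ-⊓ b x y)) (⊓-glb kx ky)

+-nonPos-≤ : ∀ b {s} → s ≤ + 0 → b + s ≤ b
+-nonPos-≤ b {s} s≤0 = subst (b + s ≤_) (+-identityʳ b) (+-monoʳ-≤ b s≤0)

≤-+-nonNeg : ∀ b {s} → + 0 ≤ s → b ≤ b + s
≤-+-nonNeg b {s} 0≤s = subst (_≤ b + s) (+-identityʳ b) (+-monoʳ-≤ b 0≤s)

lshiftArcs≤0 : ∀ {n} (as : List (Arc n)) → lshiftArcs as ≤ + 0
lshiftArcs≤0 []       = ≤-refl
lshiftArcs≤0 (a ∷ as) = i⊓j≤i (+ 0) _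

lshiftArcs-++ : ∀ {n} (xs ys : List (Arc n)) →
  lshiftArcs (xs ++ ys) ≡ lshiftArcs xs ⊓ (shiftSum xs + lshiftArcs ys)
lshiftArcs-++ [] ys = begin
  lshiftArcs ys                   ≡⟨ sym (i≥j⇒i⊓j≡j (lshiftArcs≤0 ys)) ⟩
  + 0 ⊓ lshiftArcs ys             ≡⟨ cong (+ 0 ⊓_) (sym (+-identityˡ _)) ⟩
  + 0 ⊓ (+ 0 + lshiftArcs ys)     ∎
  where open ≡-Reasoning
lshiftArcs-++ (a ∷ xs) ys = begin
  + 0 ⊓ (s + lshiftArcs (xs ++ ys))
    ≡⟨ cong (λ z → + 0 ⊓ (s + z)) (lshiftArcs-++ xs ys) ⟩
  + 0 ⊓ (s + (lshiftArcs xs ⊓ (shiftSum xs + lshiftArcs ys)))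
    ≡⟨ cong (+ 0 ⊓_) (+-distribˡ-⊓ s _ _) ⟩
  + 0 ⊓ ((s + lshiftArcs xs) ⊓ (s + (shiftSum xs + lshiftArcs ys)))
    ≡⟨ sym (⊓-assoc (+ 0) _ _) ⟩
  (+ 0 ⊓ (s + lshiftArcs xs)) ⊓ (s + (shiftSum xs + lshiftArcs ys))
    ≡⟨ cong ((+ 0 ⊓ (s + lshiftArcs xs)) ⊓_) (sym (+-assoc s _ _)) ⟩
  (+ 0 ⊓ (s + lshiftArcs xs)) ⊓ ((s + shiftSum xs) + lshiftArcs ys)
    ∎
  where
    open ≡-Reasoning
    s = shiftℤ (shift a)

shiftℤ≥-1 : ∀ s → -[1+ 0 ] ≤ shiftℤ s
shiftℤ≥-1 minus₁ = ≤-refl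
shiftℤ≥-1 zero₀  = -≤+
shiftℤ≥-1 plus₁  = -≤+

-[1+n]≡-1-n : ∀ k → -[1+ k ] ≡ -[1+ 0 ] + - (+ k)
-[1+n]≡-1-n zero    = refl
-[1+n]≡-1-n (suc k) = refl

lshiftArcs≥-length : ∀ {n} (as : List (Arc n)) → - (+ length as) ≤ lshiftArcs as
lshiftArcs≥-length []       = ≤-refl
lshiftArcs≥-length (a ∷ as) = ⊓-glb -≤+
  (subst (_≤ shiftℤ (shift a) + lshiftArcs as) (sym (-[1+n]≡-1-n (length as)))
    (+-mono-≤ (shiftℤ≥-1 (shift a)) (lshiftArcs≥-length as)))

lookup-injective : ∀ {A : Set} {xs : List A} → Unique xs → Injective _≡_ _≡_ (lookup xs)
lookup-injective {xs = _ ∷ _} (x∉xs ∷ u) {zero}  {zero}  _  = refl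
lookup-injective {xs = _ ∷ _} (x∉xs ∷ u) {zero}  {suc j} eq = ⊥-elim (All.lookup x∉xs (∈-lookup j) eq)
lookup-injective {xs = _ ∷ _} (x∉xs ∷ u) {suc i} {zero}  eq = ⊥-elim (All.lookup x∉xs (∈-lookup i) (sym eq))
lookup-injective {xs = _ ∷ _} (x∉xs ∷ u) {suc i} {suc j} eq = cong suc (lookup-injective u eq)

Unique⇒length≤ : ∀ {n} {xs : List (Fin n)} → Unique xs → length xs ≤ℕ n
Unique⇒length≤ u = injective⇒≤ (lookup-injective u)

module Factorization {n : ℕ} {A : Set} (factorOf : A → Factor n) where

  end : Fin n → List A → Fin n
  end v []       = v
  end v (x ∷ xs) = end (fTarget (factorOf x)) xs

  totalShift : List A → ℤ
  totalShift []       = + 0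
  totalShift (x ∷ xs) = fShift (factorOf x) + totalShift xs

  Admissible : A → Set
  Admissible x = (kind (factorOf x) ≡ removed → fTarget (factorOf x) ≡ fSource (factorOf x))
               × length (fArcs (factorOf x)) ≤ℕ n

  Invariant : ℤ → Fin n → ℤ → List A → Set
  Invariant m v b []       = m ≤ b
  Invariant m v b (x ∷ xs) =
    fSource (factorOf x) ≡ v × m ≤ b × Admissible x ×
    Invariant m (fTarget (factorOf x)) (b + fShift (factorOf x)) xs

  invariant-head : ∀ {m v b} xs → Invariant m v b xs → m ≤ b
  invariant-head []      m≤b            = m≤b
  invariant-head (_ ∷ _) (_ , m≤b , _) = m≤b

  invariant-++⁻ : ∀ {m v b} L {X} → Invariant m v b (L ++ X) →
    Invariant m (end v L) (b + totalShift L) X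
  invariant-++⁻ {m} {b = b} [] {X} inv = subst (λ c → Invariant m _ c X) (sym (+-identityʳ b)) inv
  invariant-++⁻ {m} {b = b} (x ∷ L) {X} (_ , _ , _ , inv) =
    subst (λ c → Invariant m _ c X) (+-assoc b _ _) (invariant-++⁻ L inv)

  invariant-++-replace : ∀ {m v b} L {X Y} → Invariant m v b (L ++ X) →
    Invariant m (end v L) (b + totalShift L) Y → Invariant m v b (L ++ Y)
  invariant-++-replace {m} {b = b} [] {Y = Y} _ inv = subst (λ c → Invariant m _ c Y) (+-identityʳ b) inv
  invariant-++-replace {m} {b = b} (x ∷ L) {Y = Y} (e , m≤b , adm , invL) inv =
    e , m≤b , adm , invariant-++-replace L invL (subst (λ c → Invariant m _ c Y) (sym (+-assoc b _ _)) inv)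

  postpone : ∀ {m v b} c P {Q} → kind (factorOf c) ≡ removed → fShift (factorOf c) ≤ + 0 →
    end v P ≡ fSource (factorOf c) → Invariant m v b (c ∷ P ++ Q) → Invariant m v b (P ++ c ∷ Q)
  postpone {m} c P {Q} isRemoved s≤0 endP (src , m≤b , adm , inv) =
    go P endP m≤b (subst (λ u → Invariant m u _ (P ++ Q)) (trans closed src) inv)
    where
      s = fShift (factorOf c)
      closed = proj₁ adm isRemoved
      go : ∀ {v b} P → end v P ≡ fSource (factorOf c) → m ≤ b →
        Invariant m v (b + s) (P ++ Q) → Invariant m v b (P ++ c ∷ Q)
      go [] endP m≤b inv =
        sym endP , m≤b , adm , subst (λ u → Invariant m u _ Q) (trans endP (sym closed)) inv
      go {b = b} (g ∷ P) endP m≤b (src , _ , admg , inv) =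
        src , m≤b , admg , go P endP (≤-trans (invariant-head (P ++ Q) inv′) (+-nonPos-≤ _ s≤0)) inv′
        where
          inv′ = subst (λ k → Invariant m _ k (P ++ Q)) (xy∙z≈xz∙y b s _) inv

  anticipate : ∀ {m v b} Q c {R} → kind (factorOf c) ≡ removed → + 0 ≤ fShift (factorOf c) →
    fSource (factorOf c) ≡ v → Invariant m v b (Q ++ c ∷ R) → Invariant m v b (c ∷ Q ++ R)
  anticipate {m} Q c {R} isRemoved 0≤s atStart inv =
    atStart , invariant-head (Q ++ c ∷ R) inv , adm ,
    subst (λ u → Invariant m u _ (Q ++ R)) (sym (trans closed atStart)) (excise Q inv)
    where
      s = fShift (factorOf c)
      adm = proj₁ (proj₂ (proj₂ (invariant-++⁻ Q inv)))
      closed = proj₁ adm isRemoved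
      excise : ∀ {v b} Q → Invariant m v b (Q ++ c ∷ R) → Invariant m v (b + s) (Q ++ R)
      excise [] (src , _ , _ , inv) = subst (λ u → Invariant m u _ R) (trans closed src) inv
      excise {b = b} (g ∷ Q) (src , m≤b , admg , inv) =
        src , ≤-trans m≤b (≤-+-nonNeg b 0≤s) , admg ,
        subst (λ k → Invariant m _ k (Q ++ R)) (xy∙z≈xz∙y b _ s) (excise Q inv)

  invariant⇒lshift≥ : ∀ {m v b} xs → Invariant m v b xs →
    m - + n ≤ b + lshiftArcs (concatMap (fArcs ∘ factorOf) xs)
  invariant⇒lshift≥ {b = b} [] m≤b = +-mono-≤ m≤b (neg-≤-pos {n} {0})
  invariant⇒lshift≥ {m} {b = b} (x ∷ xs) (_ , m≤b , (_ , short) , inv) =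
    subst (m - + n ≤_) (cong (λ z → b + z) (sym (lshiftArcs-++ (fArcs f) _)))
      (≤-+⊓ {b = b} (+-mono-≤ m≤b (≤-trans (neg-mono-≤ (+≤+ short)) (lshiftArcs≥-length (fArcs f))))
            (subst (m - + n ≤_) (+-assoc b _ _) (invariant⇒lshift≥ xs inv)))
    where f = factorOf x

module OnFactors {n : ℕ} = Factorization {n} {Factor n} id
module OnFlagged {n : ℕ} = Factorization {n} {FF n} proj₁

∈⇒memNode : ∀ {n} {u : Fin n} ws → u ∈ ws → memNode u ws ≡ true
∈⇒memNode {u = u} (w ∷ ws) (here refl) rewrite dec-true (u ≟ᶠ u) refl = refl
∈⇒memNode {u = u} (w ∷ ws) (there p)   rewrite ∈⇒memNode ws p = ∨-zeroʳ _

memNode⇒∈ : ∀ {n} {u : Fin n} ws → memNode u ws ≡ true → u ∈ ws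
memNode⇒∈ [] ()
memNode⇒∈ {u = u} (w ∷ ws) h with u ≟ᶠ w
... | yes u≡w = here u≡w
... | no _    = there (memNode⇒∈ ws h)

end-∈ : ∀ {n} (v : Fin n) L R → OnFlagged.end v L ∈ v ∷ map ffTarget (L ++ R)
end-∈ v []      R = here refl
end-∈ v (f ∷ L) R = there (end-∈ (ffTarget f) L R)

insertLast-++ : ∀ {n} (u v : Fin n) c L R → OnFlagged.end v L ≡ u →
  insertLast u v c (L ++ R) ≡ L ++ insertLast u (OnFlagged.end v L) c R
insertLast-++ u v c []      R _ = refl
insertLast-++ u v c (f ∷ L) R endL
  rewrite ∈⇒memNode (ffTarget f ∷ map ffTarget (L ++ R)) (subst (_∈ _) endL (end-∈ (ffTarget f) L R))
  = cong (f ∷_) (insertLast-++ u (ffTarget f) c L R endL)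

insertLast-split : ∀ {n} (u v : Fin n) c R → v ≡ u ⊎ u ∈ map ffTarget R →
  ∃₂ λ P Q → R ≡ P ++ Q × insertLast u v c R ≡ P ++ c ∷ Q × OnFlagged.end v P ≡ u
insertLast-split u v c [] (inj₁ v≡u) = [] , [] , refl , refl , v≡u
insertLast-split u v c (f ∷ R) u∈ with memNode u (ffTarget f ∷ map ffTarget R) in found
... | true with insertLast-split u (ffTarget f) c R (head-or-tail (memNode⇒∈ _ found))
  where
    head-or-tail : u ∈ ffTarget f ∷ map ffTarget R → ffTarget f ≡ u ⊎ u ∈ map ffTarget R
    head-or-tail (here e)  = inj₁ (sym e)
    head-or-tail (there p) = inj₂ p
...   | P , Q , refl , eq , endP = f ∷ P , Q , refl , cong (f ∷_) eq , endP
insertLast-split u v c (f ∷ R) (inj₁ v≡u) | false = [] , f ∷ R , refl , refl , v≡u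
insertLast-split u v c (f ∷ R) (inj₂ p)   | false
  with () ← trans (sym found) (∈⇒memNode (ffTarget f ∷ map ffTarget R) p)

insertFirst-split : ∀ {n} (u v : Fin n) c L R → OnFlagged.end v L ≡ u →
  ∃₂ λ P Q → L ≡ P ++ Q × insertFirst u v c (L ++ R) ≡ P ++ c ∷ Q ++ R × OnFlagged.end v P ≡ u
insertFirst-split u v c [] [] v≡u = [] , [] , refl , refl , v≡u
insertFirst-split u v c [] (g ∷ R) v≡u with v ≟ᶠ u
... | yes _  = [] , [] , refl , refl , v≡u
... | no v≢u = contradiction v≡u v≢u
insertFirst-split u v c (f ∷ L) R endL with v ≟ᶠ u
... | yes v≡u = [] , f ∷ L , refl , refl , v≡u
... | no _ with insertFirst-split u (ffTarget f) c L R endL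
...   | P , Q , refl , eq , endP = f ∷ P , Q , refl , cong (f ∷_) eq , endP

module _ {n : ℕ} {m : ℤ} {v : Fin n} where
  open OnFlagged

  -- The old position of the occurrence is a junction at its source, so insertLast puts it
  -- back at or after that position and insertFirst at or before it.
  reinsert-later : ∀ f L R → kind f ≡ removed → fShift f ≤ + 0 →
    Invariant m v (+ 0) (L ++ (f , false) ∷ R) →
    Invariant m v (+ 0) (insertLast (fSource f) v (f , true) (L ++ R))
  reinsert-later f L R isRemoved s≤0 inv
    with atL ← sym (proj₁ (invariant-++⁻ L inv))
    with P , Q , refl , inserted , endP ← insertLast-split (fSource f) (end v L) (f , true) R (inj₁ atL)
    rewrite insertLast-++ (fSource f) v (f , true) L R atL | inserted
    = invariant-++-replace L inv (postpone (f , true) P isRemoved s≤0 endP (invariant-++⁻ L inv))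

  reinsert-earlier : ∀ f L R → kind f ≡ removed → + 0 ≤ fShift f →
    Invariant m v (+ 0) (L ++ (f , false) ∷ R) →
    Invariant m v (+ 0) (insertFirst (fSource f) v (f , true) (L ++ R))
  reinsert-earlier f L R isRemoved 0≤s inv
    with atL ← sym (proj₁ (invariant-++⁻ L inv))
    with P , Q , refl , inserted , endP ← insertFirst-split (fSource f) v (f , true) L R atL
    rewrite inserted
    = invariant-++-replace P inv′
        (anticipate Q (f , false) isRemoved 0≤s (sym endP) (invariant-++⁻ P inv′))
    where inv′ = subst (Invariant m v (+ 0)) (++-assoc P Q ((f , false) ∷ R)) inv

  place-invariant : ∀ s f L R → kind f ≡ removed → fShift f ≡ s →
    Invariant m v (+ 0) (L ++ (f , false) ∷ R) → Invariant m v (+ 0) (place s v (f , true) (L ++ R))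
  place-invariant s f L R isRemoved refl inv with s <? + 0
  ... | yes s<0 = reinsert-later f L R isRemoved (<⇒≤ s<0) inv
  ... | no s≮0  = reinsert-earlier f L R isRemoved (≮⇒≥ s≮0) inv

  round-invariant : ∀ {s i r r′} → Round v s i r r′ → Invariant m v (+ 0) r → Invariant m v (+ 0) r′
  round-invariant (finish _ _) inv = inv
  round-invariant {s} (move L f R _ (isRemoved , _ , _ , shift≡s) next) inv =
    round-invariant next (place-invariant s f L R isRemoved shift≡s inv)

  rounds-invariant : ∀ {sch r r′} → Rounds v sch r r′ → Invariant m v (+ 0) r → Invariant m v (+ 0) r′
  rounds-invariant []               inv = inv
  rounds-invariant (round ∷ rounds) inv = rounds-invariant rounds (round-invariant round inv)

module _ {n : ℕ} {m : ℤ} where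
  open OnFactors

  singles-end : ∀ (a : Arc n) as → end (target a) (map singleF as) ≡ lastTarget a as
  singles-end a []       = refl
  singles-end a (b ∷ bs) = singles-end b bs

  singles-totalShift : ∀ (as : List (Arc n)) → totalShift (map singleF as) ≡ shiftSum as
  singles-totalShift []       = refl
  singles-totalShift (a ∷ as) = cong₂ _+_ (+-identityʳ (shiftℤ (shift a))) (singles-totalShift as)

  singles-invariant : ∀ {v b} (as : List (Arc n)) → 1 ≤ℕ n → Chain v as → m ≤ b + lshiftArcs as →
    Invariant m v b (map singleF as)
  singles-invariant {b = b} []       _   _          m≤ = subst (m ≤_) (+-identityʳ b) m≤
  singles-invariant {b = b} (a ∷ as) 1≤n (src , ch) m≤ =
    src , ≤-trans m≤ (+-nonPos-≤ b (lshiftArcs≤0 (a ∷ as))) , ((λ ()) , 1≤n) ,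
    singles-invariant as 1≤n ch (subst (m ≤_) shuffle (≤-trans m≤ (+-monoʳ-≤ b (i⊓j≤j (+ 0) _))))
    where
      s = shiftℤ (shift a)
      shuffle : b + (s + lshiftArcs as) ≡ (b + (s + + 0)) + lshiftArcs as
      shuffle = trans (sym (+-assoc b s _)) (cong (λ z → (b + z) + lshiftArcs as) (sym (+-identityʳ s)))

  merge-circuit : ∀ {u b} a as R → lastTarget a as ≡ source a → Unique (map source (a ∷ as)) →
    Invariant m u b (map singleF (a ∷ as) ++ R) → Invariant m u b (factor removed a as ∷ R)
  merge-circuit {b = b} a as R closed distinct inv@(src , m≤ , _) =
    src , m≤ , ((λ _ → closed) , short) ,
    subst₂ (λ u k → Invariant m u (b + k) R) (singles-end a as) (singles-totalShift (a ∷ as))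
      (invariant-++⁻ (map singleF (a ∷ as)) inv)
    where short = subst (_≤ℕ n) (length-map source (a ∷ as)) (Unique⇒length≤ distinct)

  step-invariant : ∀ {v : Fin n} {r r′} → CPDStep v r r′ →
    Invariant m v (+ 0) r → Invariant m v (+ 0) r′
  step-invariant (remove L a as R ((_ , closed , distinct) , _)) inv =
    invariant-++-replace L inv (merge-circuit a as R closed distinct (invariant-++⁻ L inv))

  decomposition-invariant : ∀ {v : Fin n} {r r′} → Star (CPDStep v) r r′ →
    Invariant m v (+ 0) r → Invariant m v (+ 0) r′
  decomposition-invariant ε            inv = inv
  decomposition-invariant (step ◅ steps) inv = decomposition-invariant steps (step-invariant step inv)

  unflagged-invariant : ∀ {v b} (r : List (Factor n)) → Invariant m v b r →
    OnFlagged.Invariant m v b (map (_, false) r)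
  unflagged-invariant []      inv                    = inv
  unflagged-invariant (f ∷ r) (src , m≤ , adm , inv) = src , m≤ , adm , unflagged-invariant r inv

mainTheorem3 : ∀ {n : ℕ} (G : StaticGraph n) (p : Path n) → IsPathIn G p →
    (r : List (Factor n)) → IsCPD p r → AssumptionA r →
    (t : Path n) → IsCPC p r t →
    lshift t ≥ lshift p - + n
mainTheorem3 {n} G p (chain , _) r (decomposition , _) _ t (out , rounds , refl) =
  subst (lshift p - + n ≤_) (+-identityˡ _) (OnFlagged.invariant⇒lshift≥ out final)
  where
    initial : OnFactors.Invariant (lshift p) (start p) (+ 0) (map singleF (arcs p))
    initial = singles-invariant (arcs p) (>-nonZero⁻¹ n {{nonZeroIndex (start p)}}) chain
                (≤-reflexive (sym (+-identityˡ _)))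
    final = rounds-invariant rounds (unflagged-invariant r (decomposition-invariant decomposition initial))
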